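{- For every positive integer $n$, $b_2(P_n) = \frac{n}{2}$ if $n$ is even and $b_2(P_n)=\frac{n-1}{2}$ if $n$ is odd.
   Context: $P_n$ denotes the path on $n$ vertices. For a finite simple graph $G=(V,E)$, a biclique on a subset of $V$ is given by two disjoint sets $X,Y\subseteq V$; its edges are all pairs $\{x,y\}$ with $x\in X$, $y\in Y$. An odd cover of $G$ is a collection of bicliques on subsets of $V$ such that every pair of vertices adjacent in $G$ is an edge of an odd number of the bicliques, and every pair of distinct non-adjacent vertices is an edge of an even number of the bicliques. $b_2(G)$ denotes the minimum cardinality of an odd cover of $G$. -}

module Defs where

open import Data.Nat using (ℕ; zero; suc; _+_; _*_; _≤_; _%_; _≡ᵇ_)
open import Data.Fin using (Fin; toℕ)
open import Data.Bool using (Bool; true; false; _∧_; _∨_; if_then_else_)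
open import Data.List using (List; length)
open import Data.Product using (Σ; _×_)
open import Relation.Binary.PropositionalEquality using (_≡_; _≢_)

record Graph (n : ℕ) : Set where
  field
    adj   : Fin n → Fin n → Bool
    sym   : ∀ i j → adj i j ≡ adj j i
    irrefl : ∀ i → adj i i ≡ false
open Graph public

pathAdj : ∀ {n} → Fin n → Fin n → Bool
pathAdj i j = (suc (toℕ i) ≡ᵇ toℕ j) ∨ (suc (toℕ j) ≡ᵇ toℕ i)

private
  ≡ᵇ-sucˡ : ∀ m → (suc m ≡ᵇ m) ≡ false
  ≡ᵇ-sucˡ zero = _≡_.refl
  ≡ᵇ-sucˡ (suc m) = ≡ᵇ-sucˡ m

  ∨-comm : ∀ a b → (a ∨ b) ≡ (b ∨ a)
  ∨-comm false false = _≡_.refl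
  ∨-comm false true = _≡_.refl
  ∨-comm true false = _≡_.refl
  ∨-comm true true = _≡_.refl

  ∨-false : ∀ a → a ≡ false → (a ∨ a) ≡ false
  ∨-false .false _≡_.refl = _≡_.refl

P : (n : ℕ) → Graph n
P n = record
  { adj = pathAdj
  ; sym = λ i j → ∨-comm (suc (toℕ i) ≡ᵇ toℕ j) (suc (toℕ j) ≡ᵇ toℕ i)
  ; irrefl = λ i → ∨-false _ (≡ᵇ-sucˡ (toℕ i))
  }

record Biclique (n : ℕ) : Set where
  field
    X Y      : Fin n → Bool
    disjoint : ∀ i → (X i ∧ Y i) ≡ false
open Biclique public

isEdge : ∀ {n} → Biclique n → Fin n → Fin n → Bool
isEdge B i j = (X B i ∧ Y B j) ∨ (X B j ∧ Y B i)

edgeCount : ∀ {n} → List (Biclique n) → Fin n → Fin n → ℕ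
edgeCount List.[] i j = 0
edgeCount (B List.∷ Bs) i j = (if isEdge B i j then 1 else 0) + edgeCount Bs i j

IsOddCover : ∀ {n} → Graph n → List (Biclique n) → Set
IsOddCover {n} G Bs = ∀ (i j : Fin n) → i ≢ j →
  edgeCount Bs i j % 2 ≡ (if adj G i j then 1 else 0)

b₂≡ : ∀ {n} → Graph n → ℕ → Set
b₂≡ G k = Σ (List (Biclique _)) (λ Bs → IsOddCover G Bs × length Bs ≡ k)
        × (∀ Bs → IsOddCover G Bs → k ≤ length Bs)

-- Over GF(2), an odd cover of G by bicliques (X₁,Y₁), …, (Xₖ,Yₖ) writes the adjacency
-- matrix as A = Σₜ (Xₜ Yₜᵀ + Yₜ Xₜᵀ), so A v is determined by the 2k bits ⟨Xₜ,v⟩, ⟨Yₜ,v⟩.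
-- For Pₙ with 2m ≤ n, v ↦ A v is injective on the 2^(2m) vectors supported on the first
-- 2m vertices, because (A v)ₐ = vₐ₋₁ + vₐ₊₁ can be solved for v two vertices at a time;
-- counting gives 2m ≤ 2k. Conversely, the stars centred at the odd vertices 1, 3, 5, …
-- partition the edges of Pₙ into ⌊n/2⌋ bicliques.
module Submission where

open import Defs
open import Data.Nat using (ℕ; suc; _*_; _+_; _≥_)
open import Data.Product using (_×_)
open import Relation.Binary.PropositionalEquality using (_≡_)

open import Algebra.Bundles using (CommutativeRing)
open import Data.Bool using (Bool; true; false; _∧_; _∨_; _xor_; if_then_else_)
open import Data.Bool.Properties
  using (xor-∧-commutativeRing; ∧-assoc; ∧-comm; ∧-zeroʳ; ∨-comm; ∨-identityʳ;
         xor-identityʳ; ∧-distribʳ-xor)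
open import Data.Fin using (Fin; zero; suc; toℕ; fromℕ<; _≟_; combine; funToFin; finToFun)
open import Data.Fin.Properties
  using (toℕ-fromℕ<; 2↔Bool; funToFin-finToFin; finToFun-funToFin; injective⇒≤)
open import Data.List using (List; []; _∷_; length; lookup; map)
open import Data.List.Properties using (length-map)
open import Data.Nat using (zero; _≤_; _<_; z≤n; s≤s; _%_; _≡ᵇ_; _^_; ⌊_/2⌋)
open import Data.Nat.Properties
  using (≤-trans; ≤-reflexive; <⇒≱; ≮⇒≥; +-mono-<; +-monoʳ-≤; +-identityʳ; +-suc;
         *-suc; ^-monoʳ-<; ⌊n/2⌋≤⌈n/2⌉; ⌊n/2⌋+⌈n/2⌉≡n)
open import Data.Nat.DivMod using (%-distribˡ-+)
open import Data.Product using (_,_)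
open import Data.Vec.Functional using (_++_)
open import Data.Vec.Functional.Properties using (++-injectiveˡ; ++-injectiveʳ)
open import Function using (_∘_; Inverse)
import Relation.Binary.PropositionalEquality as ≡
open ≡ using (refl; trans; cong; cong₂; subst; _≗_; module ≡-Reasoning)
open import Relation.Nullary using (yes; no)

GF₂ : CommutativeRing _ _
GF₂ = xor-∧-commutativeRing

open import Algebra.Properties.Semiring.Sum (CommutativeRing.semiring GF₂)
  using (sum-syntax; sum-cong-≗; sum-replicate-zero; ∑-comm; ∑-distrib-+;
         *-distribˡ-sum; *-distribʳ-sum)
open import Algebra.Properties.Group (CommutativeRing.+-group GF₂)
  using (∙-cancelˡ; ∙-cancelʳ)

open ≡-Reasoning

-- Counting bit vectors

2^m≤2^n⇒m≤n : ∀ {m n} → 2 ^ m ≤ 2 ^ n → m ≤ n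
2^m≤2^n⇒m≤n le = ≮⇒≥ (λ n<m → <⇒≱ (^-monoʳ-< 2 (s≤s (s≤s z≤n)) n<m) le)

funToFin-cong : ∀ {a c} {f g : Fin a → Fin c} → f ≗ g → funToFin f ≡ funToFin g
funToFin-cong {zero}  _   = refl
funToFin-cong {suc a} f≗g = cong₂ combine (f≗g zero) (funToFin-cong (f≗g ∘ suc))

bitsToFin : ∀ {a} → (Fin a → Bool) → Fin (2 ^ a)
bitsToFin u = funToFin (Inverse.from 2↔Bool ∘ u)

finToBits : ∀ {a} → Fin (2 ^ a) → Fin a → Bool
finToBits {a} x = Inverse.to 2↔Bool ∘ finToFun {2} {a} x

bitsToFin-injective : ∀ {a} {u v : Fin a → Bool} → bitsToFin u ≡ bitsToFin v → u ≗ v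
bitsToFin-injective {a} {u} {v} eq i = begin
  u i                           ≡⟨ strictlyInverseˡ (u i) ⟨
  to (from (u i))               ≡⟨ cong to (finToFun-funToFin (from ∘ u) i) ⟨
  to (finToFun (bitsToFin u) i) ≡⟨ cong (λ x → to (finToFun {2} {a} x i)) eq ⟩
  to (finToFun (bitsToFin v) i) ≡⟨ cong to (finToFun-funToFin (from ∘ v) i) ⟩
  to (from (v i))               ≡⟨ strictlyInverseˡ (v i) ⟩
  v i                           ∎
  where open Inverse 2↔Bool

finToBits-injective : ∀ {a} {x y : Fin (2 ^ a)} → finToBits x ≗ finToBits y → x ≡ y
finToBits-injective {a} {x} {y} eq = begin
  x                             ≡⟨ funToFin-finToFin {a} {2} x ⟨
  funToFin (finToFun {2} {a} x) ≡⟨ funToFin-cong {a} (λ i → to-injective (eq i)) ⟩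
  funToFin (finToFun {2} {a} y) ≡⟨ funToFin-finToFin {a} {2} y ⟩
  y                             ∎
  where
  open Inverse 2↔Bool
  to-injective : ∀ {b c} → to b ≡ to c → b ≡ c
  to-injective {b} {c} to≡ =
    trans (≡.sym (strictlyInverseʳ b)) (trans (cong from to≡) (strictlyInverseʳ c))

bitInjection⇒≤ : ∀ {a b} (g : (Fin a → Bool) → (Fin b → Bool)) →
                 (∀ u v → g u ≗ g v → u ≗ v) → a ≤ b
bitInjection⇒≤ g g-injective =
  2^m≤2^n⇒m≤n (injective⇒≤ {f = bitsToFin ∘ g ∘ finToBits}
    (λ eq → finToBits-injective (g-injective _ _ (bitsToFin-injective eq))))

-- Linear algebra over GF(2)

⟨_,_⟩ : ∀ {n} → (Fin n → Bool) → (Fin n → Bool) → Bool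
⟨_,_⟩ {n} x v = ∑[ i < n ] (x i ∧ v i)

_·_ : ∀ {n} → (Fin n → Fin n → Bool) → (Fin n → Bool) → Fin n → Bool
(M · v) j = ⟨ M j , v ⟩

BicliqueDecomposition : ∀ {k n} → (Fin n → Fin n → Bool) → (x y : Fin k → Fin n → Bool) → Set
BicliqueDecomposition {k} M x y =
  ∀ i i′ → M i i′ ≡ ∑[ t < k ] ((x t i ∧ y t i′) xor (x t i′ ∧ y t i))

∧-xor-rearrange : ∀ a b c d e → ((a ∧ b) xor (c ∧ d)) ∧ e ≡ (a ∧ (b ∧ e)) xor (d ∧ (c ∧ e))
∧-xor-rearrange a b c d e = begin
  ((a ∧ b) xor (c ∧ d)) ∧ e       ≡⟨ ∧-distribʳ-xor e (a ∧ b) (c ∧ d) ⟩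
  ((a ∧ b) ∧ e) xor ((c ∧ d) ∧ e) ≡⟨ cong₂ _xor_ (∧-assoc a b e)
                                      (trans (cong (_∧ e) (∧-comm c d)) (∧-assoc d c e)) ⟩
  (a ∧ (b ∧ e)) xor (d ∧ (c ∧ e)) ∎

·-bicliqueDecomposition : ∀ {k n} {M : Fin n → Fin n → Bool} {x y : Fin k → Fin n → Bool} →
  BicliqueDecomposition M x y → ∀ v j →
  (M · v) j ≡ ∑[ t < k ] ((x t j ∧ ⟨ y t , v ⟩) xor (y t j ∧ ⟨ x t , v ⟩))
·-bicliqueDecomposition {k} {n} {M} {x} {y} M≡ v j = begin
  ∑[ i < n ] (M j i ∧ v i)
    ≡⟨ sum-cong-≗ (λ i → cong (_∧ v i) (M≡ j i)) ⟩
  ∑[ i < n ] (∑[ t < k ] entry t i ∧ v i)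
    ≡⟨ sum-cong-≗ (λ i → *-distribʳ-sum (v i) (λ t → entry t i)) ⟩
  ∑[ i < n ] ∑[ t < k ] (entry t i ∧ v i)
    ≡⟨ ∑-comm (λ i t → entry t i ∧ v i) ⟩
  ∑[ t < k ] ∑[ i < n ] (entry t i ∧ v i)
    ≡⟨ sum-cong-≗ (λ t → sum-cong-≗ (λ i →
         ∧-xor-rearrange (x t j) (y t i) (x t i) (y t j) (v i))) ⟩
  ∑[ t < k ] ∑[ i < n ] ((x t j ∧ (y t i ∧ v i)) xor (y t j ∧ (x t i ∧ v i)))
    ≡⟨ sum-cong-≗ (λ t → ∑-distrib-+ (λ i → x t j ∧ (y t i ∧ v i)) (λ i → y t j ∧ (x t i ∧ v i))) ⟩
  ∑[ t < k ] (∑[ i < n ] (x t j ∧ (y t i ∧ v i)) xor ∑[ i < n ] (y t j ∧ (x t i ∧ v i)))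
    ≡⟨ sum-cong-≗ (λ t → cong₂ _xor_ (*-distribˡ-sum (x t j) (λ i → y t i ∧ v i))
                                     (*-distribˡ-sum (y t j) (λ i → x t i ∧ v i))) ⟨
  ∑[ t < k ] ((x t j ∧ ⟨ y t , v ⟩) xor (y t j ∧ ⟨ x t , v ⟩)) ∎
  where
  entry : Fin k → Fin n → Bool
  entry t i = (x t j ∧ y t i) xor (x t i ∧ y t j)

bicliqueDecomposition-rank : ∀ {k n a} {M : Fin n → Fin n → Bool} {x y : Fin k → Fin n → Bool} →
  BicliqueDecomposition M x y → (embed : (Fin a → Bool) → Fin n → Bool) →
  (∀ u v → M · embed u ≗ M · embed v → u ≗ v) → a ≤ k + k
bicliqueDecomposition-rank {k} {a = a} {M} {x} {y} M≡ embed injective =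
  bitInjection⇒≤ sketch sketch-injective
  where
  sketch : (Fin a → Bool) → Fin (k + k) → Bool
  sketch u = (λ t → ⟨ y t , embed u ⟩) ++ (λ t → ⟨ x t , embed u ⟩)

  sketch-injective : ∀ u v → sketch u ≗ sketch v → u ≗ v
  sketch-injective u v eq = injective u v λ j → begin
    (M · embed u) j ≡⟨ ·-bicliqueDecomposition {x = x} {y} M≡ (embed u) j ⟩
    _               ≡⟨ sum-cong-≗ (λ t → cong₂ _xor_ (cong (x t j ∧_) (++-injectiveˡ _ _ eq t))
                                                     (cong (y t j ∧_) (++-injectiveʳ _ _ eq t))) ⟩
    _               ≡⟨ ·-bicliqueDecomposition {x = x} {y} M≡ (embed v) j ⟨
    (M · embed v) j ∎

-- Odd covers as biclique decompositions

edgeParity : ∀ {n} → List (Biclique n) → Fin n → Fin n → Bool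
edgeParity Bs i j = ∑[ t < length Bs ] isEdge (lookup Bs t) i j

indicator-injective : ∀ {a b} → (if a then 1 else 0) ≡ (if b then 1 else 0) → a ≡ b
indicator-injective {true}  {true}  _ = refl
indicator-injective {false} {false} _ = refl

indicator-xor-%2 : ∀ a b →
  ((if a then 1 else 0) % 2 + (if b then 1 else 0)) % 2 ≡ (if a xor b then 1 else 0)
indicator-xor-%2 true  true  = refl
indicator-xor-%2 true  false = refl
indicator-xor-%2 false true  = refl
indicator-xor-%2 false false = refl

edgeCount-%2 : ∀ {n} (Bs : List (Biclique n)) i j →
               edgeCount Bs i j % 2 ≡ (if edgeParity Bs i j then 1 else 0)
edgeCount-%2 []       i j = refl
edgeCount-%2 (B ∷ Bs) i j = begin
  ((if e then 1 else 0) + edgeCount Bs i j) % 2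
    ≡⟨ %-distribˡ-+ (if e then 1 else 0) (edgeCount Bs i j) 2 ⟩
  ((if e then 1 else 0) % 2 + edgeCount Bs i j % 2) % 2
    ≡⟨ cong (λ r → ((if e then 1 else 0) % 2 + r) % 2) (edgeCount-%2 Bs i j) ⟩
  ((if e then 1 else 0) % 2 + (if edgeParity Bs i j then 1 else 0)) % 2
    ≡⟨ indicator-xor-%2 e (edgeParity Bs i j) ⟩
  (if e xor edgeParity Bs i j then 1 else 0) ∎
  where
  e : Bool
  e = isEdge B i j

isEdge-diagonal : ∀ {n} (B : Biclique n) i → isEdge B i i ≡ false
isEdge-diagonal B i = cong₂ _∨_ (disjoint B i) (disjoint B i)

∨-xor-disjoint : ∀ xi yi xj yj → xi ∧ yi ≡ false →
                 (xi ∧ yj) ∨ (xj ∧ yi) ≡ (xi ∧ yj) xor (xj ∧ yi)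
∨-xor-disjoint false _     _     _     _ = refl
∨-xor-disjoint true  false false false _ = refl
∨-xor-disjoint true  false false true  _ = refl
∨-xor-disjoint true  false true  false _ = refl
∨-xor-disjoint true  false true  true  _ = refl

isEdge-xor : ∀ {n} (B : Biclique n) i j → isEdge B i j ≡ (X B i ∧ Y B j) xor (X B j ∧ Y B i)
isEdge-xor B i j = ∨-xor-disjoint (X B i) (Y B i) (X B j) (Y B j) (disjoint B i)

oddCover-edgeParity : ∀ {n} {G : Graph n} {Bs} → IsOddCover G Bs →
                      ∀ i j → edgeParity Bs i j ≡ adj G i j
oddCover-edgeParity {G = G} {Bs} cover i j with i ≟ j
... | yes refl = trans (sum-cong-≗ (λ t → isEdge-diagonal (lookup Bs t) i))
                       (trans (sum-replicate-zero (length Bs)) (≡.sym (irrefl G i)))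
... | no  i≢j  = indicator-injective (trans (≡.sym (edgeCount-%2 Bs i j)) (cover i j i≢j))

oddCover⇒bicliqueDecomposition : ∀ {n} {G : Graph n} {Bs} → IsOddCover G Bs →
  BicliqueDecomposition (adj G) (X ∘ lookup Bs) (Y ∘ lookup Bs)
oddCover⇒bicliqueDecomposition {G = G} {Bs} cover i i′ =
  trans (≡.sym (oddCover-edgeParity {G = G} {Bs} cover i i′))
        (sum-cong-≗ (λ t → isEdge-xor (lookup Bs t) i i′))

-- Paths: the lower bound

VanishesFrom : ℕ → (ℕ → Bool) → Set
VanishesFrom k w = ∀ t → k ≤ t → w t ≡ false

zeroExtend : ∀ {a} → (Fin a → Bool) → ℕ → Bool
zeroExtend {zero}  u t       = false
zeroExtend {suc a} u zero    = u zero
zeroExtend {suc a} u (suc t) = zeroExtend (u ∘ suc) t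

zeroExtend-toℕ : ∀ {a} (u : Fin a → Bool) i → zeroExtend u (toℕ i) ≡ u i
zeroExtend-toℕ u zero    = refl
zeroExtend-toℕ u (suc i) = zeroExtend-toℕ (u ∘ suc) i

zeroExtend-vanishes : ∀ {a} (u : Fin a → Bool) → VanishesFrom a (zeroExtend u)
zeroExtend-vanishes {zero}  u t       _         = refl
zeroExtend-vanishes {suc a} u (suc t) (s≤s a≤t) = zeroExtend-vanishes (u ∘ suc) t a≤t

neighbourSum : (ℕ → Bool) → ℕ → Bool
neighbourSum w zero    = w 1
neighbourSum w (suc a) = w a xor w (suc (suc a))

∑-point : ∀ n c (w : ℕ → Bool) → VanishesFrom n w →
          ∑[ i < n ] ((c ≡ᵇ toℕ i) ∧ w (toℕ i)) ≡ w c
∑-point zero    c       w w-vanishes = ≡.sym (w-vanishes c z≤n)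
∑-point (suc n) zero    w _          =
  trans (cong (w 0 xor_) (sum-replicate-zero n)) (xor-identityʳ (w 0))
∑-point (suc n) (suc c) w w-vanishes =
  ∑-point n c (w ∘ suc) (λ t n≤t → w-vanishes (suc t) (s≤s n≤t))

neighbours-xor : ∀ b t → ((suc (suc b) ≡ᵇ t) ∨ (t ≡ᵇ b)) ≡ ((b ≡ᵇ t) xor (suc (suc b) ≡ᵇ t))
neighbours-xor zero    zero    = refl
neighbours-xor (suc b) zero    = refl
neighbours-xor zero    (suc t) = ∨-identityʳ (1 ≡ᵇ t)
neighbours-xor (suc b) (suc t) = neighbours-xor b t

path-·-toℕ : ∀ {n} {w : ℕ → Bool} → VanishesFrom n w → (j : Fin n) →
             (pathAdj · (w ∘ toℕ)) j ≡ neighbourSum w (toℕ j)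
path-·-toℕ {n} {w} w-vanishes j = row (toℕ j)
  where
  δ : ℕ → Fin n → Bool
  δ c i = (c ≡ᵇ toℕ i) ∧ w (toℕ i)

  row : ∀ a → ∑[ i < n ] (((suc a ≡ᵇ toℕ i) ∨ (suc (toℕ i) ≡ᵇ a)) ∧ w (toℕ i)) ≡ neighbourSum w a
  row zero = begin
    ∑[ i < n ] (((1 ≡ᵇ toℕ i) ∨ false) ∧ w (toℕ i))
      ≡⟨ sum-cong-≗ {n} (λ i → cong (_∧ w (toℕ i)) (∨-identityʳ (1 ≡ᵇ toℕ i))) ⟩
    ∑[ i < n ] δ 1 i
      ≡⟨ ∑-point n 1 w w-vanishes ⟩
    w 1 ∎
  row (suc b) = begin
    ∑[ i < n ] (((suc (suc b) ≡ᵇ toℕ i) ∨ (toℕ i ≡ᵇ b)) ∧ w (toℕ i))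
      ≡⟨ sum-cong-≗ {n} (λ i → trans (cong (_∧ w (toℕ i)) (neighbours-xor b (toℕ i)))
                           (∧-distribʳ-xor (w (toℕ i)) (b ≡ᵇ toℕ i) (suc (suc b) ≡ᵇ toℕ i))) ⟩
    ∑[ i < n ] (δ b i xor δ (suc (suc b)) i)
      ≡⟨ ∑-distrib-+ {n} (δ b) (δ (suc (suc b))) ⟩
    ∑[ i < n ] δ b i xor ∑[ i < n ] δ (suc (suc b)) i
      ≡⟨ cong₂ _xor_ (∑-point n b w w-vanishes) (∑-point n (suc (suc b)) w w-vanishes) ⟩
    w b xor w (suc (suc b)) ∎

neighbourSum-injective : ∀ m {w w′ : ℕ → Bool} →
  VanishesFrom (m + m) w → VanishesFrom (m + m) w′ →
  (∀ a → a < m + m → neighbourSum w a ≡ neighbourSum w′ a) → w ≗ w′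
neighbourSum-injective zero w-vanishes w′-vanishes _ t =
  trans (w-vanishes t z≤n) (≡.sym (w′-vanishes t z≤n))
neighbourSum-injective (suc m) {w} {w′} w-vanishes w′-vanishes rows = λ where
    zero          → agree₀
    (suc zero)    → agree₁
    (suc (suc t)) → agree₂₊ t
  where
  2+m+m : suc m + suc m ≡ suc (suc (m + m))
  2+m+m = cong suc (+-suc m m)

  row : ∀ a → a < suc (suc (m + m)) → neighbourSum w a ≡ neighbourSum w′ a
  row a a< = rows a (subst (a <_) (≡.sym 2+m+m) a<)

  shiftVanishing : ∀ {v} → VanishesFrom (suc m + suc m) v → VanishesFrom (m + m) (v ∘ (2 +_))
  shiftVanishing v-vanishes t m+m≤t =
    v-vanishes (2 + t) (subst (_≤ 2 + t) (≡.sym 2+m+m) (s≤s (s≤s m+m≤t)))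

  agree₁ : w 1 ≡ w′ 1
  agree₁ = row 0 (s≤s z≤n)

  -- Row 0 of the shifted vectors is w 3, which row 2 of w determines once w 1 is known.
  shiftedRows : ∀ a → a < m + m → neighbourSum (w ∘ (2 +_)) a ≡ neighbourSum (w′ ∘ (2 +_)) a
  shiftedRows zero    0<m+m = ∙-cancelˡ (w 1) _ _
    (trans (row 2 (s≤s (s≤s 0<m+m))) (cong (_xor w′ 3) (≡.sym agree₁)))
  shiftedRows (suc a) a<m+m = row (3 + a) (s≤s (s≤s a<m+m))

  agree₂₊ : ∀ t → w (2 + t) ≡ w′ (2 + t)
  agree₂₊ = neighbourSum-injective m (shiftVanishing w-vanishes) (shiftVanishing w′-vanishes)
                                     shiftedRows

  agree₀ : w 0 ≡ w′ 0
  agree₀ = ∙-cancelʳ (w 2) _ _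
    (trans (row 1 (s≤s (s≤s z≤n))) (cong (w′ 0 xor_) (≡.sym (agree₂₊ 0))))

path-·-zeroExtend-injective : ∀ {m n} → m + m ≤ n → (u v : Fin (m + m) → Bool) →
  pathAdj · (zeroExtend u ∘ toℕ) ≗ pathAdj · (zeroExtend v ∘ toℕ) → u ≗ v
path-·-zeroExtend-injective {m} {n} m+m≤n u v eq i = begin
  u i                  ≡⟨ zeroExtend-toℕ u i ⟨
  zeroExtend u (toℕ i) ≡⟨ neighbourSum-injective m (zeroExtend-vanishes u) (zeroExtend-vanishes v)
                                                  rows (toℕ i) ⟩
  zeroExtend v (toℕ i) ≡⟨ zeroExtend-toℕ v i ⟩
  v i                  ∎
  where
  vanishesFrom-n : ∀ (w : Fin (m + m) → Bool) → VanishesFrom n (zeroExtend w)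
  vanishesFrom-n w t n≤t = zeroExtend-vanishes w t (≤-trans m+m≤n n≤t)

  rows : ∀ a → a < m + m → neighbourSum (zeroExtend u) a ≡ neighbourSum (zeroExtend v) a
  rows a a<m+m = subst (λ b → neighbourSum (zeroExtend u) b ≡ neighbourSum (zeroExtend v) b)
    (toℕ-fromℕ< a<n)
    (trans (≡.sym (path-·-toℕ (vanishesFrom-n u) j))
           (trans (eq j) (path-·-toℕ (vanishesFrom-n v) j)))
    where
    a<n : a < n
    a<n = ≤-trans a<m+m m+m≤n
    j : Fin n
    j = fromℕ< a<n

m+m≤n+n⇒m≤n : ∀ {m n} → m + m ≤ n + n → m ≤ n
m+m≤n+n⇒m≤n le = ≮⇒≥ (λ n<m → <⇒≱ (+-mono-< n<m n<m) le)

path-oddCover-length : ∀ {m n} {Bs : List (Biclique n)} →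
                       m + m ≤ n → IsOddCover (P n) Bs → m ≤ length Bs
path-oddCover-length {m} {n} {Bs} m+m≤n cover = m+m≤n+n⇒m≤n
  (bicliqueDecomposition-rank {x = X ∘ lookup Bs} {Y ∘ lookup Bs}
    (oddCover⇒bicliqueDecomposition {G = P n} {Bs} cover)
    (λ u → zeroExtend u ∘ toℕ) (path-·-zeroExtend-injective {m} m+m≤n))

-- Paths: the upper bound

exactCover⇒oddCover : ∀ {n} {G : Graph n} {Bs} →
  (∀ i j → edgeCount Bs i j ≡ (if adj G i j then 1 else 0)) → IsOddCover G Bs
exactCover⇒oddCover {G = G} exact i j _ with adj G i j | exact i j
... | true  | eq = cong (_% 2) eq
... | false | eq = cong (_% 2) eq

edgeCount-sym : ∀ {n} (Bs : List (Biclique n)) i j → edgeCount Bs i j ≡ edgeCount Bs j i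
edgeCount-sym []       i j = refl
edgeCount-sym (B ∷ Bs) i j = cong₂ (λ e c → (if e then 1 else 0) + c)
  (∨-comm (X B i ∧ Y B j) (X B j ∧ Y B i)) (edgeCount-sym Bs i j)

starAtOne : ∀ {n} → Biclique (2 + n)
starAtOne = record
  { X        = λ i → toℕ i ≡ᵇ 1
  ; Y        = λ i → pathAdj i (suc zero)
  ; disjoint = λ { zero → refl ; (suc zero) → refl ; (suc (suc _)) → refl }
  }

shiftSet : ∀ {n} → (Fin n → Bool) → Fin (2 + n) → Bool
shiftSet S zero          = false
shiftSet S (suc zero)    = false
shiftSet S (suc (suc i)) = S i

shiftBiclique : ∀ {n} → Biclique n → Biclique (2 + n)
shiftBiclique B = record
  { X        = shiftSet (X B)
  ; Y        = shiftSet (Y B)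
  ; disjoint = λ { zero → refl ; (suc zero) → refl ; (suc (suc i)) → disjoint B i }
  }

pathCover : ∀ n → List (Biclique n)
pathCover zero          = []
pathCover (suc zero)    = []
pathCover (suc (suc n)) = starAtOne ∷ map shiftBiclique (pathCover n)

length-pathCover : ∀ n → length (pathCover n) ≡ ⌊ n /2⌋
length-pathCover zero          = refl
length-pathCover (suc zero)    = refl
length-pathCover (suc (suc n)) =
  cong suc (trans (length-map shiftBiclique (pathCover n)) (length-pathCover n))

edgeCount-shift : ∀ {n} (Bs : List (Biclique n)) i j →
  edgeCount (map shiftBiclique Bs) (suc (suc i)) (suc (suc j)) ≡ edgeCount Bs i j
edgeCount-shift []       i j = refl
edgeCount-shift (B ∷ Bs) i j = cong ((if isEdge B i j then 1 else 0) +_) (edgeCount-shift Bs i j)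

shiftBiclique-isEdge-low : ∀ {n} (B : Biclique n) i j → toℕ i < 2 →
                           isEdge (shiftBiclique B) i j ≡ false
shiftBiclique-isEdge-low B zero          j _ = ∧-zeroʳ (shiftSet (X B) j)
shiftBiclique-isEdge-low B (suc zero)    j _ = ∧-zeroʳ (shiftSet (X B) j)
shiftBiclique-isEdge-low B (suc (suc _)) j (s≤s (s≤s ()))

edgeCount-shift-low : ∀ {n} (Bs : List (Biclique n)) i j → toℕ i < 2 →
  edgeCount (map shiftBiclique Bs) i j ≡ 0
edgeCount-shift-low []       i j _   = refl
edgeCount-shift-low (B ∷ Bs) i j i<2 rewrite shiftBiclique-isEdge-low B i j i<2 =
  edgeCount-shift-low Bs i j i<2

starAtOne-isEdge-low : ∀ {n} (i j : Fin (2 + n)) → toℕ i < 2 → isEdge starAtOne i j ≡ pathAdj i j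
starAtOne-isEdge-low zero          zero                _ = refl
starAtOne-isEdge-low zero          (suc zero)          _ = refl
starAtOne-isEdge-low zero          (suc (suc _))       _ = refl
starAtOne-isEdge-low (suc zero)    zero                _ = refl
starAtOne-isEdge-low (suc zero)    (suc zero)          _ = refl
starAtOne-isEdge-low (suc zero)    (suc (suc zero))    _ = refl
starAtOne-isEdge-low (suc zero)    (suc (suc (suc _))) _ = refl
starAtOne-isEdge-low (suc (suc _)) _                   (s≤s (s≤s ()))

pathCover-exact-lowˡ : ∀ n (i j : Fin (2 + n)) → toℕ i < 2 →
  edgeCount (pathCover (2 + n)) i j ≡ (if pathAdj i j then 1 else 0)
pathCover-exact-lowˡ n i j i<2 = begin
  (if isEdge starAtOne i j then 1 else 0) + edgeCount (map shiftBiclique (pathCover n)) i j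
    ≡⟨ cong ((if isEdge starAtOne i j then 1 else 0) +_) (edgeCount-shift-low (pathCover n) i j i<2) ⟩
  (if isEdge starAtOne i j then 1 else 0) + 0
    ≡⟨ +-identityʳ _ ⟩
  (if isEdge starAtOne i j then 1 else 0)
    ≡⟨ cong (λ e → if e then 1 else 0) (starAtOne-isEdge-low i j i<2) ⟩
  (if pathAdj i j then 1 else 0) ∎

pathCover-exact-lowʳ : ∀ n (i j : Fin (2 + n)) → toℕ j < 2 →
  edgeCount (pathCover (2 + n)) i j ≡ (if pathAdj i j then 1 else 0)
pathCover-exact-lowʳ n i j j<2 = begin
  edgeCount (pathCover (2 + n)) i j ≡⟨ edgeCount-sym (pathCover (2 + n)) i j ⟩
  edgeCount (pathCover (2 + n)) j i ≡⟨ pathCover-exact-lowˡ n j i j<2 ⟩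
  (if pathAdj j i then 1 else 0)    ≡⟨ cong (λ e → if e then 1 else 0) (sym (P (2 + n)) j i) ⟩
  (if pathAdj i j then 1 else 0)    ∎

pathCover-exact : ∀ n (i j : Fin n) → edgeCount (pathCover n) i j ≡ (if pathAdj i j then 1 else 0)
pathCover-exact (suc zero)    zero          zero          = refl
pathCover-exact (suc (suc n)) (suc (suc i)) (suc (suc j)) =
  trans (edgeCount-shift (pathCover n) i j) (pathCover-exact n i j)
pathCover-exact (suc (suc n)) i@zero          j            = pathCover-exact-lowˡ n i j (s≤s z≤n)
pathCover-exact (suc (suc n)) i@(suc zero)    j            = pathCover-exact-lowˡ n i j (s≤s (s≤s z≤n))
pathCover-exact (suc (suc n)) i@(suc (suc _)) j@zero       = pathCover-exact-lowʳ n i j (s≤s z≤n)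
pathCover-exact (suc (suc n)) i@(suc (suc _)) j@(suc zero) = pathCover-exact-lowʳ n i j (s≤s (s≤s z≤n))

⌊n/2⌋+⌊n/2⌋≤n : ∀ n → ⌊ n /2⌋ + ⌊ n /2⌋ ≤ n
⌊n/2⌋+⌊n/2⌋≤n n = ≤-trans (+-monoʳ-≤ ⌊ n /2⌋ (⌊n/2⌋≤⌈n/2⌉ n)) (≤-reflexive (⌊n/2⌋+⌈n/2⌉≡n n))

⌊2*m/2⌋≡m : ∀ m → ⌊ 2 * m /2⌋ ≡ m
⌊2*m/2⌋≡m zero    = refl
⌊2*m/2⌋≡m (suc m) = trans (cong ⌊_/2⌋ (*-suc 2 m)) (cong suc (⌊2*m/2⌋≡m m))

⌊2*m+1/2⌋≡m : ∀ m → ⌊ 2 * m + 1 /2⌋ ≡ m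
⌊2*m+1/2⌋≡m zero    = refl
⌊2*m+1/2⌋≡m (suc m) = trans (cong (λ k → ⌊ k + 1 /2⌋) (*-suc 2 m)) (cong suc (⌊2*m+1/2⌋≡m m))

b₂-path : ∀ n → b₂≡ (P n) ⌊ n /2⌋
b₂-path n = ( pathCover n
            , exactCover⇒oddCover {G = P n} {pathCover n} (pathCover-exact n)
            , length-pathCover n )
          , λ Bs cover → path-oddCover-length {Bs = Bs} (⌊n/2⌋+⌊n/2⌋≤n n) cover

corollary4p6 : (n : ℕ) → n ≥ 1 →
    (∀ m → n ≡ 2 * m → b₂≡ (P n) m) × (∀ m → n ≡ 2 * m + 1 → b₂≡ (P n) m)
corollary4p6 n _ =
    (λ m n≡2m   → subst (b₂≡ (P n)) (trans (cong ⌊_/2⌋ n≡2m) (⌊2*m/2⌋≡m m)) (b₂-path n))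
  , (λ m n≡2m+1 → subst (b₂≡ (P n)) (trans (cong ⌊_/2⌋ n≡2m+1) (⌊2*m+1/2⌋≡m m)) (b₂-path n))
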